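{- Let $G$ be a $2$-connected $2$-leaf-stable graph with fault cost $1$, let $a_1,a_2\in V(G)$ be vertices such that $G$ has a hamiltonian $a_1a_2$-path and $G-z$ has a hamiltonian $a_1a_2$-path for every $z\in V(G)\setminus\{a_1,a_2\}$, let $\{x,y\}$ be a $2$-separator of $G$ with $xy\in E(G)$, and let $G_1,G_2$ be the two $2$-fragments of $G$ with attachment $\{x,y\}$, where $a_i\in V(G_i)$ for $i=1,2$. Then $(G_1,a_1,x,y)$ and $(G_2,a_2,x,y)$ are weak fragments, and either both of them are medium fragments or one of them is a strong fragment.
   Context: Graphs are finite, simple and undirected. A graph is hamiltonian if it has a cycle through all its vertices ($K_1,K_2$ are not); a hamiltonian $ab$-path is a path through all vertices with end-vertices $a,b$. The minimum leaf number ${\rm ml}(G)$ is $1$ if $G$ is hamiltonian, $\infty$ if disconnected, otherwise the minimum number of leaves of a spanning tree. $G$ is $2$-leaf-stable if ${\rm ml}(G)=2$ and ${\rm ml}(G-v)=2$ for all $v$. An ml-subgraph is a hamiltonian cycle if $G$ is hamiltonian, otherwise a spanning tree with ${\rm ml}(G)$ leaves; ${\cal S}_{\rm ml}(G)$ is the set of these. For $S\in{\cal S}_{\rm ml}(G)$, $v\in V(G)$, $S_v\in{\cal S}_{\rm ml}(G-v)$, $\tau(S,S_v)=|\{u\in V(G)\setminus\{v\}:\deg_S(u)\ne\deg_{S_v}(u)\}|$, $\varphi_S(G)=\max_v\min_{S_v}\tau(S,S_v)$, fault cost $\varphi(G)=\min_S\varphi_S(G)$. A $2$-separator is a set $X$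 of two vertices with $G-X$ disconnected; for a component $H$ of $G-X$, $G[V(H)\cup X]$ is a $2$-fragment with attachment $X$ (for $G$, $a_1,a_2$, $\{x,y\}$ as in the claim, there are exactly two such fragments, one containing $a_1$, the other $a_2$). For a connected graph $H$ and $a,x,y\in V(H)$ with $xy\in E(H)$: ($P_0$) $H$ has a hamiltonian $ax$- or $ay$-path, and for every $v\in V(H)\setminus\{a\}$ so does $H-v$; ($Q_1$) $H$ has no hamiltonian $xy$-path; ($Q_2$) for every $v\in V(H)\setminus\{a\}$, $H-v$ has no hamiltonian $xy$-path. $(H,a,x,y)$ is a weak fragment if ($P_0$) holds, medium if ($P_0$),($Q_1$) hold, strong if ($P_0$),($Q_1$),($Q_2$) hold. -}

module Defs where

open import Data.Bool using (Bool; true; false; _∧_; _∨_; not)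
open import Data.Nat using (ℕ; zero; suc; _≤_; _≡ᵇ_)
open import Data.Fin using (Fin)
open import Data.Fin.Properties using (_≟_)
open import Data.List using (List; []; _∷_; _++_; length; head; last; filterᵇ; allFin)
open import Data.List.Membership.Propositional using (_∈_)
open import Data.List.Relation.Unary.All using (All)
open import Data.List.Relation.Unary.Unique.Propositional using (Unique)
open import Data.Maybe using (Maybe; just; nothing)
open import Data.Product using (Σ; ∃; _×_; _,_)
open import Data.Sum using (_⊎_)
open import Function.Bundles using (_⇔_)
open import Relation.Binary.PropositionalEquality using (_≡_; _≢_)
open import Relation.Nullary using (¬_)
open import Relation.Nullary.Decidable using (isYes)

record Graph (n : ℕ) : Set where
  field
    adj   : Fin n → Fin n → Bool
    sym   : ∀ u v → adj u v ≡ adj v u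
    irrefl : ∀ v → adj v v ≡ false

open Graph public

-- Vertex subsets (used to describe induced subgraphs G[U]) and
-- edge sets (used to describe spanning subgraphs) as Bool-valued maps.
VSet : ℕ → Set
VSet n = Fin n → Bool

ESet : ℕ → Set
ESet n = Fin n → Fin n → Bool

module _ {n : ℕ} where

  full : VSet n
  full _ = true

  _─_ : VSet n → Fin n → VSet n
  (U ─ v) w = U w ∧ not (isYes (w ≟ v))

  count : (Fin n → Bool) → ℕ
  count p = length (filterᵇ p (allFin n))

  deg : ESet n → Fin n → ℕ
  deg S u = count (S u)

  data Chain (E : ESet n) : List (Fin n) → Set where
    []  : Chain E []
    [_] : ∀ v → Chain E (v ∷ [])
    _∷_ : ∀ {u v vs} → E u v ≡ true → Chain E (v ∷ vs) → Chain E (u ∷ v ∷ vs)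

  Reach : ESet n → VSet n → Fin n → Fin n → Set
  Reach E U u v = Σ (List (Fin n)) λ p →
    Chain E p × All (λ w → U w ≡ true) p × head p ≡ just u × last p ≡ just v

  Spans : VSet n → List (Fin n) → Set
  Spans U p = Unique p × (∀ v → (v ∈ p) ⇔ (U v ≡ true))

  Consec : List (Fin n) → Fin n → Fin n → Set
  Consec p u v = Σ (List (Fin n)) λ l → Σ (List (Fin n)) λ r → p ≡ l ++ (u ∷ v ∷ r)

  CycAdj : List (Fin n) → Fin n → Fin n → Set
  CycAdj p u v = Consec p u v ⊎ Consec p v u
               ⊎ (head p ≡ just u × last p ≡ just v)
               ⊎ (head p ≡ just v × last p ≡ just u)

  IsCycle : ESet n → List (Fin n) → Set
  IsCycle E p = Chain E p × Unique p × 3 ≤ length p ×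
    Σ (Fin n) λ a → Σ (Fin n) λ b → head p ≡ just a × last p ≡ just b × E b a ≡ true

  module _ (G : Graph n) where

    Connected : VSet n → Set
    Connected U = ∀ u v → U u ≡ true → U v ≡ true → Reach (adj G) U u v

    HamPath : VSet n → Fin n → Fin n → Set
    HamPath U a b = Σ (List (Fin n)) λ p →
      Chain (adj G) p × Spans U p × head p ≡ just a × last p ≡ just b

    HamCycle : VSet n → List (Fin n) → Set
    HamCycle U p = IsCycle (adj G) p × Spans U p

    Hamiltonian : VSet n → Set
    Hamiltonian U = Σ (List (Fin n)) (HamCycle U)

    IsHamCycleSub : VSet n → ESet n → Set
    IsHamCycleSub U S = Σ (List (Fin n)) λ p →
      HamCycle U p × (∀ u v → (S u v ≡ true) ⇔ CycAdj p u v)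

    IsSpanningTree : VSet n → ESet n → Set
    IsSpanningTree U S =
      (∀ u v → S u v ≡ true → adj G u v ≡ true × U u ≡ true × U v ≡ true) ×
      (∀ u v → S u v ≡ S v u) ×
      (∀ u v → U u ≡ true → U v ≡ true → Reach S U u v) ×
      (¬ Σ (List (Fin n)) (IsCycle S))

    leaves : VSet n → ESet n → ℕ
    leaves U S = count (λ v → U v ∧ (deg S v ≡ᵇ 1))

    -- ml(G[U]) = k   (ml = ∞ corresponds to no k)
    ML : VSet n → ℕ → Set
    ML U k = (k ≡ 1 × Hamiltonian U)
           ⊎ (¬ Hamiltonian U ×
              (Σ (ESet n) λ S → IsSpanningTree U S × leaves U S ≡ k) ×
              (∀ T → IsSpanningTree U T → k ≤ leaves U T))

    IsMLSub : VSet n → ESet n → Set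
    IsMLSub U S = (Hamiltonian U × IsHamCycleSub U S)
                ⊎ (¬ Hamiltonian U × IsSpanningTree U S ×
                   (∀ T → IsSpanningTree U T → leaves U S ≤ leaves U T))

    TwoLeafStable : Set
    TwoLeafStable = ML full 2 × (∀ v → ML (full ─ v) 2)

    τ : ESet n → Fin n → ESet n → ℕ
    τ S v Sv = count (λ u → not (isYes (u ≟ v)) ∧ not (deg S u ≡ᵇ deg Sv u))

    -- φ_S(G) ≤ k  and  φ_S(G) ≥ k  (values in ℕ ∪ {∞}, min ∅ = ∞)
    φS≤ : ESet n → ℕ → Set
    φS≤ S k = ∀ v → Σ (ESet n) λ Sv → IsMLSub (full ─ v) Sv × τ S v Sv ≤ k

    φS≥ : ESet n → ℕ → Set
    φS≥ S k = Σ (Fin n) λ v → ∀ Sv → IsMLSub (full ─ v) Sv → k ≤ τ S v Sv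

    FaultCost : ℕ → Set
    FaultCost k = (Σ (ESet n) λ S → IsMLSub full S × φS≤ S k)
                × (∀ S → IsMLSub full S → φS≥ S k)

    TwoConnected : Set
    TwoConnected = 3 ≤ n × Connected full × (∀ v → Connected (full ─ v))

    TwoSeparator : Fin n → Fin n → Set
    TwoSeparator x y = x ≢ y × ¬ Connected ((full ─ x) ─ y)

    IsComponent : VSet n → VSet n → Set
    IsComponent U C = (Σ (Fin n) λ c → C c ≡ true)
                    × (∀ v → C v ≡ true → U v ≡ true)
                    × Connected C
                    × (∀ u v → C u ≡ true → U v ≡ true → adj G u v ≡ true → C v ≡ true)

    -- vertex set of the 2-fragment G[V(C) ∪ {x,y}]
    fragment : VSet n → Fin n → Fin n → VSet n
    fragment C x y v = C v ∨ isYes (v ≟ x) ∨ isYes (v ≟ y)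

    P₀ : VSet n → Fin n → Fin n → Fin n → Set
    P₀ U a x y = (HamPath U a x ⊎ HamPath U a y)
               × (∀ v → U v ≡ true → v ≢ a → HamPath (U ─ v) a x ⊎ HamPath (U ─ v) a y)

    Q₁ : VSet n → Fin n → Fin n → Set
    Q₁ U x y = ¬ HamPath U x y

    Q₂ : VSet n → Fin n → Fin n → Fin n → Set
    Q₂ U a x y = ∀ v → U v ≡ true → v ≢ a → ¬ HamPath (U ─ v) x y

    FragmentData : VSet n → Fin n → Fin n → Fin n → Set
    FragmentData U a x y = Connected U × U a ≡ true × U x ≡ true × U y ≡ true × adj G x y ≡ true

    WeakFragment : VSet n → Fin n → Fin n → Fin n → Set
    WeakFragment U a x y = FragmentData U a x y × P₀ U a x y

    MediumFragment : VSet n → Fin n → Fin n → Fin n → Set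
    MediumFragment U a x y = WeakFragment U a x y × Q₁ U x y

    StrongFragment : VSet n → Fin n → Fin n → Fin n → Set
    StrongFragment U a x y = MediumFragment U a x y × Q₂ U a x y

module Submission where

-- The two fragments are weak because a hamiltonian a₁a₂-path P of G, or of G − z, restricts to
-- them: P starts in C₁ and can leave C₁ only through x or y, so the vertices of G₁ taken in the
-- order of P form a path from a₁ to x or y; when P visits C₂ between x and y, this subsequence
-- jumps from one to the other along the edge xy. The same path shows that a₁ ∈ C₁, a₂ ∈ C₂ and
-- that C₁ ∪ C₂ contains every vertex other than x and y. Gluing a hamiltonian xy-path of G₂ to
-- one of G₁, or of G₁ − v, along x and y gives a hamiltonian cycle of G, or of G − v, which
-- 2-leaf-stability excludes. So if G₂ has a hamiltonian xy-path then G₁ is strong, if G₁ has one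
-- then G₂ is strong, and otherwise both are medium.

open import Defs hiding (sym)
open import Data.Bool using (true; false; _∧_; _∨_; not)
import Data.Bool.Properties as Bool
open import Data.Nat using (ℕ; zero; suc; _+_; _≤_; z≤n; s≤s)
open import Data.Nat.Properties using (≤-trans; ≤-reflexive; +-suc)
open import Data.Fin using (Fin)
open import Data.Fin.Properties using (_≟_; any?; all?)
open import Data.List using (List; []; _∷_; _++_; _∷ʳ_; length; head; last; reverse; filter)
open import Data.List.Properties using (++-assoc; filter-++; filter-all; filter-none; filter-accept; unfold-reverse; reverse-involutive; length-++; length-tabulate)
open import Data.List.Membership.Propositional using (_∈_; _∉_)
open import Data.List.Membership.Propositional.Properties using (∈-filter⁺; ∈-filter⁻; ∈-++⁺ˡ; ∈-++⁺ʳ; ∈-++⁻; ∈-∃++; ∈-allFin)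
open import Data.List.Relation.Unary.Any using (here; there)
import Data.List.Relation.Unary.Any.Properties as Any
open import Data.List.Relation.Unary.All as All using (All; []; _∷_)
import Data.List.Relation.Unary.All.Properties as All
open import Data.List.Relation.Unary.Unique.Propositional using (Unique)
import Data.List.Relation.Unary.Unique.Propositional.Properties as Unique
open import Data.List.Relation.Unary.AllPairs using ([]; _∷_)
import Data.List.Relation.Unary.First as First
import Data.List.Relation.Unary.First.Properties as First
import Data.List.Relation.Binary.Permutation.Setoid as Perm
open import Data.List.Relation.Binary.Permutation.Setoid.Properties using (Unique-resp-↭; ↭-reverse)
open import Data.Maybe using (just)
open import Data.Maybe.Properties using (≡-dec)
open import Data.Product using (∃; _×_; _,_; proj₁; proj₂)
open import Data.Sum as Sum using (_⊎_; inj₁; inj₂)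
open import Data.Empty using (⊥; ⊥-elim)
open import Function.Bundles using (_⇔_; mk⇔; Equivalence)
open import Relation.Binary.PropositionalEquality using (_≡_; _≢_; refl; sym; trans; cong; cong₂; subst; setoid; module ≡-Reasoning)
open import Relation.Nullary using (¬_; Dec; yes; no)
open import Relation.Nullary.Decidable using (map′; _×-dec_; _→-dec_)

module _ {A : Set} where

  head-++ : ∀ {xs ys : List A} {a} → head xs ≡ just a → head (xs ++ ys) ≡ just a
  head-++ {_ ∷ _} h = h

  last-++ : ∀ (xs : List A) y ys → last (xs ++ y ∷ ys) ≡ last (y ∷ ys)
  last-++ []           y ys = refl
  last-++ (x ∷ [])     y ys = refl
  last-++ (x ∷ z ∷ xs) y ys = last-++ (z ∷ xs) y ys

  last-reverse : ∀ (xs : List A) → last (reverse xs) ≡ head xs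
  last-reverse []       = refl
  last-reverse (x ∷ xs) rewrite unfold-reverse x xs = last-++ (reverse xs) x []

  head-reverse : ∀ (xs : List A) → head (reverse xs) ≡ last xs
  head-reverse xs = begin
    head (reverse xs)            ≡⟨ sym (last-reverse (reverse xs)) ⟩
    last (reverse (reverse xs))  ≡⟨ cong last (reverse-involutive xs) ⟩
    last xs                      ∎
    where open ≡-Reasoning

  ∈-head : ∀ {xs : List A} {v} → head xs ≡ just v → v ∈ xs
  ∈-head {_ ∷ _} refl = here refl

  ∈-last : ∀ (xs : List A) {v} → last xs ≡ just v → v ∈ xs
  ∈-last (x ∷ [])     refl = here refl
  ∈-last (x ∷ y ∷ xs) l    = there (∈-last (y ∷ xs) l)

  Unique-reverse : ∀ {xs : List A} → Unique xs → Unique (reverse xs)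
  Unique-reverse {xs} = Unique-resp-↭ (setoid A) (Perm.↭-sym (setoid A) (↭-reverse (setoid A) xs))

  unique-⊆⇒length≤ : ∀ {xs ys : List A} → Unique xs → (∀ {v} → v ∈ xs → v ∈ ys) →
                      length xs ≤ length ys
  unique-⊆⇒length≤ {[]}     _          _   = z≤n
  unique-⊆⇒length≤ {x ∷ xs} (x∉xs ∷ u) xs⊆ys with ∈-∃++ (xs⊆ys (here refl))
  ... | l , r , refl = ≤-trans (s≤s (unique-⊆⇒length≤ u xs⊆l++r))
                               (≤-reflexive (length-insert l r))
    where
    length-insert : ∀ l r → suc (length (l ++ r)) ≡ length (l ++ x ∷ r)
    length-insert l r = begin
      suc (length (l ++ r))      ≡⟨ cong suc (length-++ l) ⟩
      suc (length l + length r)  ≡⟨ sym (+-suc (length l) (length r)) ⟩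
      length l + length (x ∷ r)  ≡⟨ sym (length-++ l) ⟩
      length (l ++ x ∷ r)        ∎
      where open ≡-Reasoning
    xs⊆l++r : ∀ {v} → v ∈ xs → v ∈ l ++ r
    xs⊆l++r {v} v∈xs with ∈-++⁻ l (xs⊆ys (there v∈xs))
    ... | inj₁ v∈l         = ∈-++⁺ˡ v∈l
    ... | inj₂ (here refl) = ⊥-elim (All.lookup x∉xs v∈xs refl)
    ... | inj₂ (there v∈r) = ∈-++⁺ʳ l v∈r

  Unique-∷ʳ⁻ : ∀ {xs : List A} {b} → Unique (xs ∷ʳ b) → Unique xs × b ∉ xs
  Unique-∷ʳ⁻ {[]}     _          = [] , λ ()
  Unique-∷ʳ⁻ {x ∷ xs} (x∉ ∷ u) with Unique-∷ʳ⁻ u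
  ... | u′ , b∉xs = All.++⁻ˡ xs x∉ ∷ u′ , λ { (here refl) → All.lookup (All.++⁻ʳ xs x∉) (here refl) refl
                                            ; (there b∈xs) → b∉xs b∈xs }

  Unique-++⁻ʳ : ∀ (xs : List A) {ys} → Unique (xs ++ ys) → Unique ys
  Unique-++⁻ʳ []       u       = u
  Unique-++⁻ʳ (x ∷ xs) (_ ∷ u) = Unique-++⁻ʳ xs u

  length≥3 : ∀ (xs : List A) {a b w} → head xs ≡ just a → last xs ≡ just b → a ≢ b →
             w ∈ xs → w ≢ a → w ≢ b → 3 ≤ length xs
  length≥3 (x ∷ [])         refl refl a≢b _                  _   _   = ⊥-elim (a≢b refl)
  length≥3 (x ∷ y ∷ [])     refl refl _   (here refl)         w≢a _   = ⊥-elim (w≢a refl)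
  length≥3 (x ∷ y ∷ [])     refl refl _   (there (here refl)) _   w≢b = ⊥-elim (w≢b refl)
  length≥3 (x ∷ y ∷ z ∷ xs) _    _    _   _                   _   _   = s≤s (s≤s (s≤s z≤n))

  split-last : ∀ (xs : List A) {b} → last xs ≡ just b → ∃ λ I → xs ≡ I ∷ʳ b
  split-last (x ∷ [])     refl = [] , refl
  split-last (x ∷ y ∷ xs) l    with split-last (y ∷ xs) l
  ... | I , eq = x ∷ I , cong (x ∷_) eq

  split-ends : ∀ (xs : List A) {a b} → head xs ≡ just a → last xs ≡ just b → a ≢ b →
               ∃ λ I → xs ≡ a ∷ I ∷ʳ b
  split-ends (x ∷ [])     refl refl a≢b = ⊥-elim (a≢b refl)
  split-ends (x ∷ y ∷ xs) refl l    _   with split-last (y ∷ xs) l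
  ... | I , eq = I , cong (x ∷_) eq

  last-nonempty : ∀ (x : A) xs → ∃ λ d → last (x ∷ xs) ≡ just d
  last-nonempty x []       = x , refl
  last-nonempty x (y ∷ xs) = last-nonempty y xs

  ∈-tail : ∀ {x : A} {xs v} → v ∈ x ∷ xs → v ≢ x → v ∈ xs
  ∈-tail (here v≡x) v≢x = ⊥-elim (v≢x v≡x)
  ∈-tail (there v∈) _   = v∈

  ∈-interior : ∀ (I : List A) {a b v} → v ∈ a ∷ I ∷ʳ b → v ≢ a → v ≢ b → v ∈ I
  ∈-interior I v∈ v≢a v≢b with ∈-++⁻ I (∈-tail v∈ v≢a)
  ... | inj₁ v∈I        = v∈I
  ... | inj₂ (here v≡b) = ⊥-elim (v≢b v≡b)

  module _ {P : A → Set} (P? : ∀ v → Dec (P v)) where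

    filter-once : ∀ xs {s} ys → All P xs → P s → All (λ v → ¬ P v) ys → filter P? (xs ++ s ∷ ys) ≡ xs ∷ʳ s
    filter-once xs {s} ys Pxs Ps ¬Pys = begin
      filter P? (xs ++ s ∷ ys)            ≡⟨ filter-++ P? xs (s ∷ ys) ⟩
      filter P? xs ++ filter P? (s ∷ ys)  ≡⟨ cong₂ _++_ (filter-all P? Pxs) (filter-accept P? Ps) ⟩
      xs ++ s ∷ filter P? ys              ≡⟨ cong (λ r → xs ++ s ∷ r) (filter-none P? ¬Pys) ⟩
      xs ∷ʳ s                             ∎
      where open ≡-Reasoning

    filter-twice : ∀ xs {s} ys {t} zs → All P xs → P s → P t → All (λ v → ¬ P v) zs →
                   filter P? (xs ++ s ∷ ys ++ t ∷ zs) ≡ xs ++ s ∷ filter P? ys ++ t ∷ []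
    filter-twice xs {s} ys {t} zs Pxs Ps Pt ¬Pzs = begin
      filter P? (xs ++ s ∷ ys ++ t ∷ zs)            ≡⟨ filter-++ P? xs (s ∷ ys ++ t ∷ zs) ⟩
      filter P? xs ++ filter P? (s ∷ ys ++ t ∷ zs)  ≡⟨ cong₂ _++_ (filter-all P? Pxs) (filter-accept P? Ps) ⟩
      xs ++ s ∷ filter P? (ys ++ t ∷ zs)            ≡⟨ cong (λ r → xs ++ s ∷ r) (filter-++ P? ys (t ∷ zs)) ⟩
      xs ++ s ∷ filter P? ys ++ filter P? (t ∷ zs)  ≡⟨ cong (λ r → xs ++ s ∷ filter P? ys ++ r)
                                                          (filter-accept P? Pt) ⟩
      xs ++ s ∷ filter P? ys ++ t ∷ filter P? zs    ≡⟨ cong (λ r → xs ++ s ∷ filter P? ys ++ t ∷ r)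
                                                          (filter-none P? ¬Pzs) ⟩
      xs ++ s ∷ filter P? ys ++ t ∷ []              ∎
      where open ≡-Reasoning

  All-reverse : ∀ {P : A → Set} {xs} → All P xs → All P (reverse xs)
  All-reverse Pxs = All.tabulate (λ v∈ → All.lookup Pxs (Any.reverse⁻ v∈))

_⇔-dec_ : ∀ {A B : Set} → Dec A → Dec B → Dec (A ⇔ B)
A? ⇔-dec B? = map′ (λ (f , g) → mk⇔ f g) (λ A⇔B → Equivalence.to A⇔B , Equivalence.from A⇔B)
                   ((A? →-dec B?) ×-dec (B? →-dec A?))

module _ {n : ℕ} where

  unique⇒length≤ : ∀ {xs : List (Fin n)} → Unique xs → length xs ≤ n
  unique⇒length≤ u = ≤-trans (unique-⊆⇒length≤ u (λ {v} _ → ∈-allFin v))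
                             (≤-reflexive (length-tabulate (λ i → i)))

  ∃-length≤? : ∀ k {P : List (Fin n) → Set} → (∀ xs → Dec (P xs)) →
               Dec (∃ λ xs → length xs ≤ k × P xs)
  ∃-length≤? k P? with P? []
  ... | yes p[] = yes ([] , z≤n , p[])
  ∃-length≤? zero    P? | no ¬p[] = no λ { ([] , _ , p[]) → ¬p[] p[] }
  ∃-length≤? (suc k) P? | no ¬p[] with any? (λ v → ∃-length≤? k (λ xs → P? (v ∷ xs)))
  ... | yes (v , xs , ≤k , p) = yes (v ∷ xs , s≤s ≤k , p)
  ... | no ¬q = no λ { ([] , _ , p[]) → ¬p[] p[] ; (v ∷ xs , s≤s ≤k , p) → ¬q (v , xs , ≤k , p) }

module _ {n : ℕ} {U : VSet n} {v w : Fin n} where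

  ─⁺ : U w ≡ true → w ≢ v → (U ─ v) w ≡ true
  ─⁺ Uw w≢v with U w | w ≟ v
  ... | true | no _    = refl
  ... | true | yes w≡v = ⊥-elim (w≢v w≡v)

  ─⁻ : (U ─ v) w ≡ true → U w ≡ true × w ≢ v
  ─⁻ h with U w | w ≟ v
  ... | true | no w≢v = refl , w≢v

module _ {n : ℕ} where

  _∪_ : VSet n → VSet n → VSet n
  (K₁ ∪ K₂) v = K₁ v ∨ K₂ v

  _∖_ : VSet n → VSet n → VSet n
  (W ∖ K) v = W v ∧ not (K v)

  module _ {K₁ K₂ : VSet n} {v : Fin n} where

    ∪⁺ : K₁ v ≡ true ⊎ K₂ v ≡ true → (K₁ ∪ K₂) v ≡ true
    ∪⁺ (inj₁ K₁v) = cong (_∨ K₂ v) K₁v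
    ∪⁺ (inj₂ K₂v) = trans (cong (K₁ v ∨_) K₂v) (Bool.∨-zeroʳ (K₁ v))

    ∪⁻ : (K₁ ∪ K₂) v ≡ true → K₁ v ≡ true ⊎ K₂ v ≡ true
    ∪⁻ h with K₁ v
    ... | true  = inj₁ refl
    ... | false = inj₂ h

    ∖⁺ : K₁ v ≡ true → K₂ v ≡ false → (K₁ ∖ K₂) v ≡ true
    ∖⁺ K₁v K₂v rewrite K₁v | K₂v = refl

    ∖⁻ : (K₁ ∖ K₂) v ≡ true → K₁ v ≡ true × K₂ v ≡ false
    ∖⁻ h with K₁ v | K₂ v
    ... | true | false = refl , refl

-- Chains, walks and hamiltonian paths

module _ {n : ℕ} {E : ESet n} where

  chain-tail : ∀ {v vs} → Chain E (v ∷ vs) → Chain E vs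
  chain-tail [ _ ]   = []
  chain-tail (_ ∷ c) = c

  chain-++⁺ : ∀ xs {u v ys} → Chain E xs → last xs ≡ just u → E u v ≡ true →
              Chain E (v ∷ ys) → Chain E (xs ++ v ∷ ys)
  chain-++⁺ (x ∷ [])     [ _ ]    refl uv c′ = uv ∷ c′
  chain-++⁺ (x ∷ y ∷ xs) (e ∷ c) l    uv c′ = e ∷ chain-++⁺ (y ∷ xs) c l uv c′

  chain-++⁻ˡ : ∀ xs {ys} → Chain E (xs ++ ys) → Chain E xs
  chain-++⁻ˡ []           _       = []
  chain-++⁻ˡ (x ∷ [])     _       = [ x ]
  chain-++⁻ˡ (x ∷ y ∷ xs) (e ∷ c) = e ∷ chain-++⁻ˡ (y ∷ xs) c

  chain-++⁻ʳ : ∀ xs {ys} → Chain E (xs ++ ys) → Chain E ys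
  chain-++⁻ʳ []       c = c
  chain-++⁻ʳ (x ∷ xs) c = chain-++⁻ʳ xs (chain-tail c)

  chain-prefix : ∀ A {s R} → Chain E (A ++ s ∷ R) → Chain E (A ∷ʳ s)
  chain-prefix A {s} {R} c = chain-++⁻ˡ (A ∷ʳ s) (subst (Chain E) (sym (++-assoc A (s ∷ []) R)) c)

  chain-last-edge : ∀ xs {u v} → Chain E (xs ∷ʳ v) → last xs ≡ just u → E u v ≡ true
  chain-last-edge (x ∷ [])     (e ∷ _) refl = e
  chain-last-edge (x ∷ y ∷ xs) (_ ∷ c) l    = chain-last-edge (y ∷ xs) c l

  chain? : ∀ xs → Dec (Chain E xs)
  chain? []           = yes []
  chain? (x ∷ [])     = yes [ x ]
  chain? (x ∷ y ∷ xs) with E x y Bool.≟ true | chain? (y ∷ xs)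
  ... | yes e  | yes c  = yes (e ∷ c)
  ... | no ¬e  | _      = no λ { (e ∷ _) → ¬e e }
  ... | yes _  | no ¬c  = no λ { (_ ∷ c) → ¬c c }

module _ {n : ℕ} (G : Graph n) where

  private
    E : ESet n
    E = adj G

  adj-sym : ∀ {u v} → E u v ≡ true → E v u ≡ true
  adj-sym {u} {v} e = trans (Graph.sym G v u) e

  chain-reverse : ∀ {xs} → Chain E xs → Chain E (reverse xs)
  chain-reverse []    = []
  chain-reverse [ v ] = [ v ]
  chain-reverse {u ∷ v ∷ vs} (e ∷ c) rewrite unfold-reverse u (v ∷ vs) =
    chain-++⁺ (reverse (v ∷ vs)) (chain-reverse c) (last-reverse (v ∷ vs)) (adj-sym e) [ u ]

  module _ {W : VSet n} where

    reach-refl : ∀ {u} → W u ≡ true → Reach E W u u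
    reach-refl {u} Wu = u ∷ [] , [ u ] , Wu ∷ [] , refl , refl

    reach-sym : ∀ {u v} → Reach E W u v → Reach E W v u
    reach-sym (p , c , Wp , h , l) =
      reverse p , chain-reverse c , All-reverse Wp , trans (head-reverse p) l , trans (last-reverse p) h

    reach-cons : ∀ {u v w} → E u v ≡ true → W u ≡ true → Reach E W v w → Reach E W u w
    reach-cons {u} e Wu (v ∷ p , c , Wp , refl , l) = u ∷ v ∷ p , e ∷ c , Wu ∷ Wp , refl , l

    chain-reach : ∀ {p u v} → Chain E p → All (λ w → W w ≡ true) p → u ∈ p → v ∈ p → Reach E W u v
    chain-reach _       (Wu ∷ _)   (here refl) (here refl) = reach-refl Wu
    chain-reach (e ∷ c) (Wu ∷ Wp) (here refl) (there v∈)  = reach-cons e Wu (chain-reach c Wp (here refl) v∈)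
    chain-reach (e ∷ c) (Wv ∷ Wp) (there u∈)  (here refl) =
      reach-sym (reach-cons e Wv (chain-reach c Wp (here refl) u∈))
    chain-reach (e ∷ c) (_ ∷ Wp)  (there u∈)  (there v∈)  = chain-reach c Wp u∈ v∈

  module _ {U : VSet n} where

    hamPath-head : ∀ {a b} → HamPath G U a b → U a ≡ true
    hamPath-head (_ , _ , (_ , sp) , h , _) = Equivalence.to (sp _) (∈-head h)

    hamPath-last : ∀ {a b} → HamPath G U a b → U b ≡ true
    hamPath-last (p , _ , (_ , sp) , _ , l) = Equivalence.to (sp _) (∈-last p l)

    hamPath⇒connected : ∀ {a b} → HamPath G U a b → Connected G U
    hamPath⇒connected (_ , c , (_ , sp) , _) u v Uu Uv =
      chain-reach c (All.tabulate (Equivalence.to (sp _))) (Equivalence.from (sp u) Uu) (Equivalence.from (sp v) Uv)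

    hamPath-reverse : ∀ {a b} → HamPath G U a b → HamPath G U b a
    hamPath-reverse (p , c , (u , sp) , h , l) =
      reverse p , chain-reverse c ,
      (Unique-reverse u , λ v → mk⇔ (λ v∈ → Equivalence.to (sp v) (Any.reverse⁻ v∈))
                                    (λ Uv → Any.reverse⁺ (Equivalence.from (sp v) Uv))) ,
      trans (head-reverse p) l , trans (last-reverse p) h

    hamPath-loop : ∀ {a v} → HamPath G U a a → U v ≡ true → v ≡ a
    hamPath-loop (p , _ , (u , sp) , h , l) Uv = go p u h l (Equivalence.from (sp _) Uv)
      where
      go : ∀ p {a v} → Unique p → head p ≡ just a → last p ≡ just a → v ∈ p → v ≡ a
      go (x ∷ [])     _          refl _ (here refl) = refl
      go (x ∷ y ∷ xs) _          refl _ (here refl) = refl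
      go (x ∷ y ∷ xs) (x∉ ∷ _)  refl l (there _)   = ⊥-elim (All.lookup x∉ (∈-last (y ∷ xs) l) refl)

    hamPath-close : ∀ {a b w} → HamPath G U a b → E b a ≡ true → a ≢ b →
                    U w ≡ true → w ≢ a → w ≢ b → Hamiltonian G U
    hamPath-close {a} {b} (p , c , (u , sp) , h , l) ba a≢b Uw w≢a w≢b =
      p , (c , u , length≥3 p h l a≢b (Equivalence.from (sp _) Uw) w≢a w≢b , a , b , h , l , ba) , (u , sp)

    hamPath-interior : ∀ {a b w} → HamPath G U a b → a ≢ b → U w ≡ true → w ≢ a → w ≢ b →
                       ∃ λ c → ∃ λ d → E a c ≡ true × E d b ≡ true × HamPath G ((U ─ a) ─ b) c d
    hamPath-interior {a} {b} {w} (p , ch , (u , sp) , h , l) a≢b Uw w≢a w≢b with split-ends p h l a≢b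
    ... | [] , refl with Equivalence.from (sp w) Uw
    ...   | here w≡a         = ⊥-elim (w≢a w≡a)
    ...   | there (here w≡b) = ⊥-elim (w≢b w≡b)
    hamPath-interior {a} {b} (_ , ac ∷ ch , (a∉ ∷ u , sp) , refl , l) _ _ _ _ | c ∷ J , refl
      with last-nonempty c J | Unique-∷ʳ⁻ u
    ... | d , ld | uI , b∉I =
      c , d , ac , chain-last-edge (c ∷ J) ch ld , (c ∷ J , chain-++⁻ˡ (c ∷ J) ch , (uI , spans) , refl , ld)
      where
      spans : ∀ v → (v ∈ c ∷ J) ⇔ (((U ─ a) ─ b) v ≡ true)
      spans v = mk⇔
        (λ v∈ → ─⁺ {U = U ─ a} (─⁺ {U = U} (Equivalence.to (sp v) (there (∈-++⁺ˡ v∈)))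
                        (λ v≡a → All.lookup a∉ (∈-++⁺ˡ v∈) (sym v≡a)))
                    (λ { refl → b∉I v∈ }))
        (λ v∈U → let (v∈U−a , v≢b) = ─⁻ {U = U ─ a} v∈U ; (Uv , v≢a) = ─⁻ {U = U} v∈U−a in
                 ∈-interior (c ∷ J) (Equivalence.from (sp v) Uv) v≢a v≢b)

  spans-++ : ∀ {U V W : VSet n} {p q} → Spans U p → Spans V q → (∀ v → U v ≡ true → V v ≡ true → ⊥) →
             (∀ v → (W v ≡ true) ⇔ (U v ≡ true ⊎ V v ≡ true)) → Spans W (p ++ q)
  spans-++ {p = p} (up , spp) (uq , spq) U∩V W⇔U⊎V =
    Unique.++⁺ up uq (λ (v∈p , v∈q) → U∩V _ (Equivalence.to (spp _) v∈p) (Equivalence.to (spq _) v∈q)) ,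
    λ v → mk⇔
      (λ v∈ → Equivalence.from (W⇔U⊎V v) (Sum.map (Equivalence.to (spp v)) (Equivalence.to (spq v)) (∈-++⁻ p v∈)))
      (λ Wv → Sum.[ (λ Uv → ∈-++⁺ˡ (Equivalence.from (spp v) Uv)) , (λ Vv → ∈-++⁺ʳ p (Equivalence.from (spq v) Vv)) ]
                (Equivalence.to (W⇔U⊎V v) Wv))

  hamPath-join : ∀ {U V W : VSet n} {a b c d} → HamPath G U a b → HamPath G V c d → E b c ≡ true →
                 (∀ v → U v ≡ true → V v ≡ true → ⊥) →
                 (∀ v → (W v ≡ true) ⇔ (U v ≡ true ⊎ V v ≡ true)) → HamPath G W a d
  hamPath-join (p , cp , sp , hp , lp) (c ∷ q , cq , sq , refl , lq) bc U∩V W⇔U⊎V =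
    p ++ c ∷ q , chain-++⁺ p cp lp bc cq , spans-++ sp sq U∩V W⇔U⊎V , head-++ hp , trans (last-++ p c q) lq

  -- P₁ followed by the reversed interior of P₂ is a hamiltonian path of W from x to a neighbour of x.
  hamPaths-glue : ∀ {T₁ T₂ W : VSet n} {x y w} → x ≢ y → HamPath G T₁ x y → HamPath G T₂ x y →
                  T₂ w ≡ true → w ≢ x → w ≢ y →
                  (∀ v → (W v ≡ true) ⇔ (T₁ v ≡ true ⊎ T₂ v ≡ true)) →
                  (∀ v → T₁ v ≡ true → T₂ v ≡ true → v ≡ x ⊎ v ≡ y) → Hamiltonian G W
  hamPaths-glue {T₁} {T₂} {W} {x} {y} x≢y P₁ P₂ T₂w w≢x w≢y W⇔T₁⊎T₂ T₁∩T₂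
    with hamPath-interior P₂ x≢y T₂w w≢x w≢y
  ... | c , d , xc , dy , P₂° =
    hamPath-close (hamPath-join P₁ (hamPath-reverse P₂°) (adj-sym dy) disjoint cover)
                  (adj-sym xc) (λ x≡c → c≢x (sym x≡c)) Wy (λ y≡x → x≢y (sym y≡x)) (λ y≡c → c≢y (sym y≡c))
    where
    interior⁻ : ∀ {v} → ((T₂ ─ x) ─ y) v ≡ true → T₂ v ≡ true × v ≢ x × v ≢ y
    interior⁻ h = let (h′ , v≢y) = ─⁻ {U = T₂ ─ x} h ; (T₂v , v≢x) = ─⁻ {U = T₂} h′ in T₂v , v≢x , v≢y

    c≢x : c ≢ x
    c≢x = proj₁ (proj₂ (interior⁻ (hamPath-head P₂°)))

    c≢y : c ≢ y
    c≢y = proj₂ (proj₂ (interior⁻ (hamPath-head P₂°)))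

    Wy : W y ≡ true
    Wy = Equivalence.from (W⇔T₁⊎T₂ y) (inj₁ (hamPath-last P₁))

    disjoint : ∀ v → T₁ v ≡ true → ((T₂ ─ x) ─ y) v ≡ true → ⊥
    disjoint v T₁v h with interior⁻ h
    ... | T₂v , v≢x , v≢y = Sum.[ v≢x , v≢y ] (T₁∩T₂ v T₁v T₂v)

    cover : ∀ v → (W v ≡ true) ⇔ (T₁ v ≡ true ⊎ ((T₂ ─ x) ─ y) v ≡ true)
    cover v = mk⇔ to (Sum.[ (λ T₁v → Equivalence.from (W⇔T₁⊎T₂ v) (inj₁ T₁v))
                          , (λ h → Equivalence.from (W⇔T₁⊎T₂ v) (inj₂ (proj₁ (interior⁻ h)))) ])
      where
      to : W v ≡ true → T₁ v ≡ true ⊎ ((T₂ ─ x) ─ y) v ≡ true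
      to Wv = split (Equivalence.to (W⇔T₁⊎T₂ v) Wv) (v ≟ x) (v ≟ y)
        where
        split : T₁ v ≡ true ⊎ T₂ v ≡ true → Dec (v ≡ x) → Dec (v ≡ y) →
                T₁ v ≡ true ⊎ ((T₂ ─ x) ─ y) v ≡ true
        split (inj₁ T₁v) _          _          = inj₁ T₁v
        split (inj₂ _)   (yes refl) _          = inj₁ (hamPath-head P₁)
        split (inj₂ _)   (no _)     (yes refl) = inj₁ (hamPath-last P₁)
        split (inj₂ T₂v) (no v≢x)   (no v≢y)   = inj₂ (─⁺ {U = T₂ ─ x} (─⁺ {U = T₂} T₂v v≢x) v≢y)

  -- A hamiltonian path repeats no vertex, so lists of length at most n suffice.
  hamPath? : ∀ (U : VSet n) a b → Dec (HamPath G U a b)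
  hamPath? U a b = map′ (λ (p , _ , path) → p , path)
                        (λ (p , path) → p , unique⇒length≤ (proj₁ (proj₁ (proj₂ path))) , path)
                        (∃-length≤? n path?)
    where
    open import Data.List.Membership.DecPropositional (_≟_ {n}) using (_∈?_)
    open import Data.List.Relation.Unary.Unique.DecPropositional (_≟_ {n}) using (unique?)
    path? : ∀ p → Dec (Chain E p × Spans U p × head p ≡ just a × last p ≡ just b)
    path? p = chain? p
         ×-dec (unique? p ×-dec all? (λ v → (v ∈? p) ⇔-dec (U v Bool.≟ true)))
         ×-dec ≡-dec _≟_ (head p) (just a)
         ×-dec ≡-dec _≟_ (last p) (just b)

  ML-2⇒¬Hamiltonian : ∀ {U : VSet n} → ML G U 2 → ¬ Hamiltonian G U
  ML-2⇒¬Hamiltonian (inj₁ (() , _))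
  ML-2⇒¬Hamiltonian (inj₂ (¬ham , _)) = ¬ham

  module _ {C : VSet n} {x y v : Fin n} where

    fragment⁺ : C v ≡ true ⊎ v ≡ x ⊎ v ≡ y → fragment G C x y v ≡ true
    fragment⁺ h with C v | v ≟ x | v ≟ y | h
    ... | true  | _        | _        | _                = refl
    ... | false | yes _    | _        | _                = refl
    ... | false | no _     | yes _    | _                = refl
    ... | false | no v≢x   | no _     | inj₂ (inj₁ v≡x)  = ⊥-elim (v≢x v≡x)
    ... | false | no _     | no v≢y   | inj₂ (inj₂ v≡y)  = ⊥-elim (v≢y v≡y)

    fragment⁻ : fragment G C x y v ≡ true → C v ≡ true ⊎ v ≡ x ⊎ v ≡ y
    fragment⁻ h with C v | v ≟ x | v ≟ y
    ... | true  | _        | _        = inj₁ refl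
    ... | false | yes v≡x  | _        = inj₂ (inj₁ v≡x)
    ... | false | no _     | yes v≡y  = inj₂ (inj₂ v≡y)

  -- Closed vertex sets and components

  Closed : VSet n → VSet n → Set
  Closed W K = ∀ u v → K u ≡ true → W v ≡ true → E u v ≡ true → K v ≡ true

  component-closed : ∀ {W C} → IsComponent G W C → Closed W C
  component-closed (_ , _ , _ , closed) = closed

  module _ {W K : VSet n} (closed : Closed W K) where

    closed-edge : ∀ {u v} → W u ≡ true → W v ≡ true → E u v ≡ true → K u ≡ K v
    closed-edge {u} {v} Wu Wv uv with K u in Ku | K v in Kv
    ... | true  | true  = refl
    ... | false | false = refl
    ... | true  | false = trans (sym (closed u v Ku Wv uv)) Kv
    ... | false | true  = trans (sym Ku) (closed v u Kv Wu (adj-sym uv))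

    closed-chain : ∀ {p u v} → Chain E p → All (λ w → W w ≡ true) p → u ∈ p → v ∈ p → K u ≡ K v
    closed-chain _       _          (here refl) (here refl) = refl
    closed-chain (e ∷ c) (Wu ∷ Wp) (here refl) (there v∈) =
      trans (closed-edge Wu (All.head Wp) e) (closed-chain c Wp (here refl) v∈)
    closed-chain (e ∷ c) (Wv ∷ Wp) (there u∈) (here refl) =
      sym (trans (closed-edge Wv (All.head Wp) e) (closed-chain c Wp (here refl) u∈))
    closed-chain (e ∷ c) (_ ∷ Wp)   (there u∈) (there v∈) = closed-chain c Wp u∈ v∈

    closed-chain-dichotomy : ∀ {p} → Chain E p → All (λ w → W w ≡ true) p →
                             All (λ w → K w ≡ true) p ⊎ All (λ w → K w ≡ false) p
    closed-chain-dichotomy {[]}    _ _  = inj₁ []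
    closed-chain-dichotomy {u ∷ p} c Wp with K u in Ku
    ... | true  = inj₁ (All.tabulate (λ w∈ → trans (closed-chain c Wp w∈ (here refl)) Ku))
    ... | false = inj₂ (All.tabulate (λ w∈ → trans (closed-chain c Wp w∈ (here refl)) Ku))

  component-spread : ∀ {W C K u v} → IsComponent G W C → Closed W K →
                     C u ≡ true → K u ≡ true → C v ≡ true → K v ≡ true
  component-spread {u = u} {v} (_ , C⊆W , connected , _) closed Cu Ku Cv with connected u v Cu Cv
  ... | p , c , Cp , h , l = trans (closed-chain closed c (All.map (C⊆W _) Cp) (∈-last p l) (∈-head h)) Ku

  component-unique : ∀ {W C C′ v} → IsComponent G W C → IsComponent G W C′ →
                     C v ≡ true → C′ v ≡ true → ∀ w → C w ≡ C′ w
  component-unique {C = C} {C′} comp comp′ Cv C′v w with C w in Cw | C′ w in C′w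
  ... | true  | true  = refl
  ... | false | false = refl
  ... | true  | false = trans (sym (component-spread comp (component-closed comp′) Cv C′v Cw)) C′w
  ... | false | true  = trans (sym Cw) (component-spread comp′ (component-closed comp) C′v Cv C′w)

  components-disjoint : ∀ {W C C′} → IsComponent G W C → IsComponent G W C′ → ¬ (∀ v → C v ≡ C′ v) →
                        ∀ v → C v ≡ true → C′ v ≡ true → ⊥
  components-disjoint comp comp′ C≢C′ v Cv C′v = C≢C′ (component-unique comp comp′ Cv C′v)

  ∪-closed : ∀ {W K₁ K₂} → Closed W K₁ → Closed W K₂ → Closed W (K₁ ∪ K₂)
  ∪-closed {W} {K₁} {K₂} closed₁ closed₂ u v Ku Wv uv =
    ∪⁺ {K₁ = K₁} {K₂ = K₂}
       (Sum.map (λ K₁u → closed₁ u v K₁u Wv uv) (λ K₂u → closed₂ u v K₂u Wv uv) (∪⁻ {K₁ = K₁} {K₂ = K₂} Ku))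

  leftover-component : ∀ {W K M v} → Closed W K → Chain E M → All (λ w → W w ≡ true) M →
                       v ∈ M → K v ≡ false → (∀ w → W w ≡ true → K w ≡ false → w ∈ M) →
                       IsComponent G W (W ∖ K)
  leftover-component {W} {K} {M} {v} closed c WM v∈M Kv leftover⊆M =
    (v , D⁺ (All.lookup WM v∈M) Kv) ,
    (λ w h → proj₁ (D⁻ h)) ,
    (λ u w hu hw → chain-reach c M⊆D (D⊆M hu) (D⊆M hw)) ,
    (λ u w hu Ww uw → let (Wu , Ku) = D⁻ hu in D⁺ Ww (trans (sym (closed-edge closed Wu Ww uw)) Ku))
    where
    D⁺ : ∀ {w} → W w ≡ true → K w ≡ false → (W ∖ K) w ≡ true
    D⁺ = ∖⁺ {K₁ = W} {K₂ = K}
    D⁻ : ∀ {w} → (W ∖ K) w ≡ true → W w ≡ true × K w ≡ false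
    D⁻ = ∖⁻ {K₁ = W} {K₂ = K}
    D⊆M : ∀ {w} → (W ∖ K) w ≡ true → w ∈ M
    D⊆M {w} h = let (Ww , Kw) = D⁻ h in leftover⊆M w Ww Kw
    M⊆D : All (λ w → (W ∖ K) w ≡ true) M
    M⊆D = All.tabulate (λ w∈M → D⁺ (All.lookup WM w∈M) (trans (closed-chain closed c WM w∈M v∈M) Kv))

-- Paths through the separator {x, y}

module Separator {n : ℕ} (G : Graph n) {x y : Fin n} (x≢y : x ≢ y) (xy : adj G x y ≡ true) where

  private
    E : ESet n
    E = adj G

  U : VSet n
  U = (full ─ x) ─ y

  InU : Fin n → Set
  InU v = U v ≡ true

  Sep : Fin n → Set
  Sep v = v ≡ x ⊎ v ≡ y

  U⁺ : ∀ {v} → v ≢ x → v ≢ y → InU v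
  U⁺ v≢x v≢y = ─⁺ {U = full ─ x} (─⁺ {U = full} refl v≢x) v≢y

  U⁻ : ∀ {v} → InU v → v ≢ x × v ≢ y
  U⁻ h = proj₂ (─⁻ {U = full} (proj₁ (─⁻ {U = full ─ x} h))) , proj₂ (─⁻ {U = full ─ x} h)

  Sep⇒∉U : ∀ {v} → Sep v → ¬ InU v
  Sep⇒∉U sep Uv = Sum.[ proj₁ (U⁻ Uv) , proj₂ (U⁻ Uv) ] sep

  U-or-Sep : ∀ v → InU v ⊎ Sep v
  U-or-Sep v = decide (v ≟ x) (v ≟ y)
    where
    decide : Dec (v ≡ x) → Dec (v ≡ y) → InU v ⊎ Sep v
    decide (yes v≡x) _         = inj₂ (inj₁ v≡x)
    decide (no _)    (yes v≡y) = inj₂ (inj₂ v≡y)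
    decide (no v≢x)  (no v≢y)  = inj₁ (U⁺ v≢x v≢y)

  Sep-other : ∀ {s} → Sep s → ∃ λ t → Sep t × s ≢ t
  Sep-other (inj₁ refl) = y , inj₂ refl , x≢y
  Sep-other (inj₂ refl) = x , inj₁ refl , λ y≡x → x≢y (sym y≡x)

  Sep-cases : ∀ {s t v} → Sep s → Sep t → s ≢ t → Sep v → v ≡ s ⊎ v ≡ t
  Sep-cases (inj₁ refl) (inj₁ refl) s≢t _          = ⊥-elim (s≢t refl)
  Sep-cases (inj₂ refl) (inj₂ refl) s≢t _          = ⊥-elim (s≢t refl)
  Sep-cases (inj₁ refl) (inj₂ refl) _   (inj₁ v≡x) = inj₁ v≡x
  Sep-cases (inj₁ refl) (inj₂ refl) _   (inj₂ v≡y) = inj₂ v≡y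
  Sep-cases (inj₂ refl) (inj₁ refl) _   (inj₁ v≡x) = inj₂ v≡x
  Sep-cases (inj₂ refl) (inj₁ refl) _   (inj₂ v≡y) = inj₁ v≡y

  Sep-adjacent : ∀ {s t} → Sep s → Sep t → s ≢ t → E s t ≡ true
  Sep-adjacent (inj₁ refl) (inj₁ refl) s≢t = ⊥-elim (s≢t refl)
  Sep-adjacent (inj₂ refl) (inj₂ refl) s≢t = ⊥-elim (s≢t refl)
  Sep-adjacent (inj₁ refl) (inj₂ refl) _   = xy
  Sep-adjacent (inj₂ refl) (inj₁ refl) _   = adj-sym G xy

  data Crossing (p : List (Fin n)) : Set where
    avoids : All InU p → Crossing p
    once   : ∀ A s B → p ≡ A ++ s ∷ B → Sep s → All InU A → All InU B → Crossing p
    twice  : ∀ A s M t B → p ≡ A ++ s ∷ M ++ t ∷ B → Sep s → Sep t → s ≢ t →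
             All InU A → All InU M → All InU B → Crossing p

  crossing-twice : ∀ A {s} M {t} B → Unique (A ++ s ∷ M ++ t ∷ B) → Sep s → Sep t →
                   All InU A → All InU M → Crossing (A ++ s ∷ M ++ t ∷ B)
  crossing-twice A {s} M {t} B u sep sep′ UA UM with Unique-++⁻ʳ A u
  ... | s∉ ∷ u′ with Unique-++⁻ʳ M u′
  ... | t∉B ∷ _ = twice A s M t B refl sep sep′ s≢t UA UM (All.tabulate UB)
    where
    s∉t∷B : All (s ≢_) (t ∷ B)
    s∉t∷B = All.++⁻ʳ M s∉
    s≢t : s ≢ t
    s≢t = All.head s∉t∷B
    UB : ∀ {w} → w ∈ B → InU w
    UB {w} w∈B with U-or-Sep w
    ... | inj₁ Uw = Uw
    ... | inj₂ sepw with Sep-cases sep sep′ s≢t sepw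
    ...   | inj₁ w≡s = ⊥-elim (All.lookup s∉t∷B (there w∈B) (sym w≡s))
    ...   | inj₂ w≡t = ⊥-elim (All.lookup t∉B w∈B (sym w≡t))

  crossing : ∀ {p} → Unique p → Crossing p
  crossing {p} u with First.first U-or-Sep p
  ... | inj₂ Up = avoids Up
  ... | inj₁ f with First.toView f
  ... | First._++_∷_ {A} {s} UA sep R with First.first U-or-Sep R
  ...   | inj₂ UR = once A s R refl sep UA UR
  ...   | inj₁ f′ with First.toView f′
  ...     | First._++_∷_ {M} UM sep′ B = crossing-twice A M B u sep sep′ UA UM

  module _ {K : VSet n} (closed : Closed G U K) where

    segment-before : ∀ A {s R a v} → Chain E (A ++ s ∷ R) → All InU A →
                     head (A ++ s ∷ R) ≡ just a → v ∈ A → K v ≡ K a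
    segment-before (a ∷ A) c UA refl v∈A = closed-chain G closed (chain-++⁻ˡ (a ∷ A) c) UA v∈A (here refl)

    segment-after : ∀ R {t B b v} → Chain E (R ++ t ∷ B) → All InU B →
                    last (R ++ t ∷ B) ≡ just b → v ∈ B → K v ≡ K b
    segment-after R {t} {b′ ∷ B} c UB l v∈B =
      closed-chain G closed (chain-tail (chain-++⁻ʳ R c)) UB v∈B
                   (∈-last (b′ ∷ B) (trans (sym (last-++ R t (b′ ∷ B))) l))

  reassoc : ∀ (A : List (Fin n)) s M t B → A ++ s ∷ M ++ t ∷ B ≡ (A ++ s ∷ M) ++ t ∷ B
  reassoc A s M t B = sym (++-assoc A (s ∷ M) (t ∷ B))

  module Restriction {C : VSet n} (comp : IsComponent G U C) where

    F : VSet n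
    F = fragment G C x y

    F? : ∀ v → Dec (F v ≡ true)
    F? v = F v Bool.≟ true

    F⁺ : ∀ {v} → C v ≡ true ⊎ Sep v → F v ≡ true
    F⁺ {v} = fragment⁺ G {C} {x} {y} {v}

    F⁻ : ∀ {v} → F v ≡ true → C v ≡ true ⊎ Sep v
    F⁻ {v} = fragment⁻ G {C} {x} {y} {v}

    private
      closedC : Closed G U C
      closedC = component-closed G comp

    outside⇒∉F : ∀ {v} → InU v → C v ≡ false → ¬ F v ≡ true
    outside⇒∉F Uv Cv Fv with F⁻ Fv
    ... | inj₁ Cv′ = Bool.not-¬ Cv′ Cv
    ... | inj₂ sep = Sep⇒∉U sep Uv

    PathToSep : List (Fin n) → Set
    PathToSep q = Chain E q × ∃ λ s → Sep s × last q ≡ just s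

    restriction-once : ∀ A s B {a b} → Chain E (A ++ s ∷ B) →
                       head (A ++ s ∷ B) ≡ just a → last (A ++ s ∷ B) ≡ just b → C a ≡ true → C b ≡ false →
                       Sep s → All InU A → All InU B → PathToSep (filter F? (A ++ s ∷ B))
    restriction-once A s B c h l Ca Cb sep UA UB =
      subst PathToSep (sym (filter-once F? A B FA (F⁺ (inj₂ sep)) ∉FB)) (chain-prefix A c , s , sep , last-++ A s [])
      where
      FA : All (λ v → F v ≡ true) A
      FA = All.tabulate λ v∈ → F⁺ (inj₁ (trans (segment-before closedC A c UA h v∈) Ca))
      ∉FB : All (λ v → ¬ F v ≡ true) B
      ∉FB = All.tabulate λ v∈ → outside⇒∉F (All.lookup UB v∈) (trans (segment-after closedC A c UB l v∈) Cb)

    restriction-twice : ∀ A s M t B {a b} → Chain E (A ++ s ∷ M ++ t ∷ B) →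
                        head (A ++ s ∷ M ++ t ∷ B) ≡ just a → last (A ++ s ∷ M ++ t ∷ B) ≡ just b →
                        C a ≡ true → C b ≡ false → Sep s → Sep t → s ≢ t →
                        All InU A → All InU M → All InU B → PathToSep (filter F? (A ++ s ∷ M ++ t ∷ B))
    restriction-twice A s M t B {b = b} c h l Ca Cb sep sep′ s≢t UA UM UB =
      finish (closed-chain-dichotomy G closedC (chain-++⁻ˡ M (chain-tail (chain-++⁻ʳ A c))) UM)
      where
      c′ : Chain E ((A ++ s ∷ M) ++ t ∷ B)
      c′ = subst (Chain E) (reassoc A s M t B) c

      l′ : last ((A ++ s ∷ M) ++ t ∷ B) ≡ just b
      l′ = subst (λ q → last q ≡ just b) (reassoc A s M t B) l

      FA : All (λ v → F v ≡ true) A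
      FA = All.tabulate λ v∈ → F⁺ (inj₁ (trans (segment-before closedC A c UA h v∈) Ca))

      ∉FB : All (λ v → ¬ F v ≡ true) B
      ∉FB = All.tabulate λ v∈ → outside⇒∉F (All.lookup UB v∈)
              (trans (segment-after closedC (A ++ s ∷ M) c′ UB l′ v∈) Cb)

      filtered : ∀ {M′} → filter F? M ≡ M′ → filter F? (A ++ s ∷ M ++ t ∷ B) ≡ A ++ s ∷ M′ ++ t ∷ []
      filtered M↦M′ = trans (filter-twice F? A M B FA (F⁺ (inj₂ sep)) (F⁺ (inj₂ sep′)) ∉FB)
                            (cong (λ m → A ++ s ∷ m ++ t ∷ []) M↦M′)

      finish : All (λ v → C v ≡ true) M ⊎ All (λ v → C v ≡ false) M → PathToSep (filter F? (A ++ s ∷ M ++ t ∷ B))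
      finish (inj₁ CM) =
        subst PathToSep (sym (filtered (filter-all F? (All.map (λ Cv → F⁺ (inj₁ Cv)) CM))))
          (subst (Chain E) (++-assoc A (s ∷ M) (t ∷ [])) (chain-prefix (A ++ s ∷ M) c′) ,
           t , sep′ , trans (last-++ A s (M ∷ʳ t)) (last-++ (s ∷ M) t []))
      -- The middle segment avoids C, so the restriction jumps across it along the edge st.
      finish (inj₂ ¬CM) =
        subst PathToSep (sym (filtered (filter-none F? (All.tabulate λ v∈ →
                                          outside⇒∉F (All.lookup UM v∈) (All.lookup ¬CM v∈)))))
          (subst (Chain E) (++-assoc A (s ∷ []) (t ∷ []))
             (chain-++⁺ (A ∷ʳ s) (chain-prefix A c) (last-++ A s []) (Sep-adjacent sep sep′ s≢t) [ t ]) ,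
           t , sep′ , last-++ A s (t ∷ []))

    restriction : ∀ {p a b} → Chain E p → Unique p → head p ≡ just a → last p ≡ just b →
                  C a ≡ true → C b ≡ false → PathToSep (filter F? p)
    restriction {p} c u h l Ca Cb with crossing u
    ... | avoids Up = ⊥-elim (Bool.not-¬ (trans (sym (closed-chain G closedC c Up (∈-head h) (∈-last p l))) Ca) Cb)
    ... | once A s B refl sep UA UB = restriction-once A s B c h l Ca Cb sep UA UB
    ... | twice A s M t B refl sep sep′ s≢t UA UM UB = restriction-twice A s M t B c h l Ca Cb sep sep′ s≢t UA UM UB

    hamPath-restrict : ∀ {W T : VSet n} {a b} → HamPath G W a b → C a ≡ true → C b ≡ false →
                       (∀ v → (T v ≡ true) ⇔ (W v ≡ true × F v ≡ true)) →
                       HamPath G T a x ⊎ HamPath G T a y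
    hamPath-restrict {W} {T} {a} (a ∷ p , c , (u , sp) , refl , l) Ca Cb T⇔W∩F
      with restriction c u refl l Ca Cb
    ... | c′ , s , sep , l′ =
      Sum.map (λ s≡x → subst (HamPath G T a) s≡x path) (λ s≡y → subst (HamPath G T a) s≡y path) sep
      where
      spans : ∀ v → (v ∈ filter F? (a ∷ p)) ⇔ (T v ≡ true)
      spans v = mk⇔
        (λ v∈ → let (v∈p , Fv) = ∈-filter⁻ F? v∈ in Equivalence.from (T⇔W∩F v) (Equivalence.to (sp v) v∈p , Fv))
        (λ Tv → let (Wv , Fv) = Equivalence.to (T⇔W∩F v) Tv in ∈-filter⁺ F? (Equivalence.from (sp v) Wv) Fv)
      path : HamPath G T a s
      path = filter F? (a ∷ p) , c′ , (Unique.filter⁺ F? u , spans) ,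
             cong head (filter-accept F? (F⁺ (inj₁ Ca))) , l′

  module _ {C : VSet n} (comp : IsComponent G U C) where
    open Restriction comp

    fragment-weak : ∀ {a b} → C a ≡ true → InU b → C b ≡ false → HamPath G full a b →
                    (∀ z → z ≢ a → z ≢ b → HamPath G (full ─ z) a b) → WeakFragment G F a x y
    fragment-weak {a} {b} Ca Ub Cb hp hz =
      (connected , F⁺ (inj₁ Ca) , F⁺ (inj₂ (inj₁ refl)) , F⁺ (inj₂ (inj₂ refl)) , xy) , whole , minus
      where
      whole : HamPath G F a x ⊎ HamPath G F a y
      whole = hamPath-restrict hp Ca Cb (λ v → mk⇔ (refl ,_) proj₂)

      connected : Connected G F
      connected = Sum.[ hamPath⇒connected G , hamPath⇒connected G ] whole

      minus : ∀ v → F v ≡ true → v ≢ a → HamPath G (F ─ v) a x ⊎ HamPath G (F ─ v) a y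
      minus v Fv v≢a = hamPath-restrict (hz v v≢a v≢b) Ca Cb λ w → mk⇔
        (λ h → let (Fw , w≢v) = ─⁻ {U = F} h in ─⁺ {U = full} refl w≢v , Fw)
        (λ (h , Fw) → ─⁺ {U = F} Fw (proj₂ (─⁻ {U = full} h)))
        where
        v≢b : v ≢ b
        v≢b refl = outside⇒∉F Ub Cb Fv

  module _ {C C′ : VSet n} (comp : IsComponent G U C) (comp′ : IsComponent G U C′)
           (C∩C′ : ∀ v → C v ≡ true → C′ v ≡ true → ⊥)
           (¬ham : ∀ z → ¬ Hamiltonian G (full ─ z)) {a a′ : Fin n}
           (hp : HamPath G full a a′) (hz : ∀ z → z ≢ a → z ≢ a′ → HamPath G (full ─ z) a a′) where

    private
      c c′ : Fin n
      c  = proj₁ (proj₁ comp)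
      c′ = proj₁ (proj₁ comp′)
      Cc : C c ≡ true
      Cc = proj₂ (proj₁ comp)
      C′c′ : C′ c′ ≡ true
      C′c′ = proj₂ (proj₁ comp′)
      Uc : InU c
      Uc = proj₁ (proj₂ comp) c Cc
      Uc′ : InU c′
      Uc′ = proj₁ (proj₂ comp′) c′ C′c′

    -- After its first vertex a ∈ {x, y}, a hamiltonian path of G − t stays in U, hence in one component.
    endpoint-beyond-separator : ∀ {t} → Sep a → Sep t → a ≢ t → C′ a′ ≡ true → ⊥
    endpoint-beyond-separator {t} sep sep-t a≢t C′a′ = go (hz t (λ t≡a → a≢t (sym t≡a)) λ { refl → Sep⇒∉U sep-t Ua′ })
      where
      Ua′ : InU a′
      Ua′ = proj₁ (proj₂ comp′) a′ C′a′
      go : HamPath G (full ─ t) a a′ → ⊥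
      go (_ ∷ rest , ch , (a∉ ∷ _ , sp) , refl , l) =
        C∩C′ a′ (trans (sym (closed-chain G (component-closed G comp) (chain-tail ch) Urest c∈ a′∈)) Cc) C′a′
        where
        Urest : All InU rest
        Urest = All.tabulate rest⊆U
          where
          rest⊆U : ∀ {w} → w ∈ rest → InU w
          rest⊆U {w} w∈ with U-or-Sep w
          ... | inj₁ Uw    = Uw
          ... | inj₂ sep-w with Sep-cases sep sep-t a≢t sep-w
          ...   | inj₁ refl = ⊥-elim (All.lookup a∉ w∈ refl)
          ...   | inj₂ refl = ⊥-elim (proj₂ (─⁻ {U = full} (Equivalence.to (sp w) (there w∈))) refl)
        c∈ : c ∈ rest
        c∈ = ∈-tail (Equivalence.from (sp c) (─⁺ {U = full} refl λ { refl → Sep⇒∉U sep-t Uc }))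
                    λ { refl → Sep⇒∉U sep Uc }
        a′∈ : a′ ∈ rest
        a′∈ = ∈-tail (∈-last (a ∷ rest) l) λ { refl → Sep⇒∉U sep Ua′ }

    endpoint-not-in-separator : Sep a → fragment G C′ x y a′ ≡ true → ⊥
    endpoint-not-in-separator sep Fa′ with Sep-other sep | fragment⁻ G {C′} {x} {y} {a′} Fa′
    ... | t , sep-t , a≢t | inj₁ C′a′ = endpoint-beyond-separator sep sep-t a≢t C′a′
    ... | t , sep-t , a≢t | inj₂ sep′ with Sep-cases sep sep-t a≢t sep′
    ...   | inj₁ refl = Sep⇒∉U (subst Sep (sym (hamPath-loop G {v = c} hp refl)) sep) Uc
    ...   | inj₂ refl = ¬ham c (hamPath-close G (hz c c≢a c≢t) (Sep-adjacent sep-t sep (λ t≡a → a≢t (sym t≡a))) a≢t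
                                 (─⁺ {U = full} refl c′≢c) (λ { refl → Sep⇒∉U sep Uc′ })
                                 (λ { refl → Sep⇒∉U sep-t Uc′ }))
      where
      c≢a : c ≢ a
      c≢a refl = Sep⇒∉U sep Uc
      c≢t : c ≢ t
      c≢t refl = Sep⇒∉U sep-t Uc
      c′≢c : c′ ≢ c
      c′≢c refl = C∩C′ c Cc C′c′

    endpoint-in-component : fragment G C x y a ≡ true → fragment G C′ x y a′ ≡ true → C a ≡ true
    endpoint-in-component Fa Fa′ with fragment⁻ G {C} {x} {y} {a} Fa
    ... | inj₁ Ca  = Ca
    ... | inj₂ sep = ⊥-elim (endpoint-not-in-separator sep Fa′)

  once-∈-Sep : ∀ A s B {w} → w ∈ A ++ s ∷ B → Sep w → All InU A → All InU B → w ≡ s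
  once-∈-Sep A s B w∈ sep-w UA UB with ∈-++⁻ A w∈
  ... | inj₁ w∈A         = ⊥-elim (Sep⇒∉U sep-w (All.lookup UA w∈A))
  ... | inj₂ (here w≡s)  = w≡s
  ... | inj₂ (there w∈B) = ⊥-elim (Sep⇒∉U sep-w (All.lookup UB w∈B))

  twice-∈-U : ∀ A s M t B {w} → w ∈ A ++ s ∷ M ++ t ∷ B → InU w → Sep s → Sep t → w ∈ A ⊎ w ∈ M ⊎ w ∈ B
  twice-∈-U A s M t B w∈ Uw sep sep′ with ∈-++⁻ A w∈
  ... | inj₁ w∈A         = inj₁ w∈A
  ... | inj₂ (here refl) = ⊥-elim (Sep⇒∉U sep Uw)
  ... | inj₂ (there w∈′) with ∈-++⁻ M w∈′
  ...   | inj₁ w∈M         = inj₂ (inj₁ w∈M)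
  ...   | inj₂ (here refl) = ⊥-elim (Sep⇒∉U sep′ Uw)
  ...   | inj₂ (there w∈B) = inj₂ (inj₂ w∈B)

  module _ {C₁ C₂ : VSet n} (comp₁ : IsComponent G U C₁) (comp₂ : IsComponent G U C₂)
           (only : ∀ C → IsComponent G U C → (∀ v → C v ≡ C₁ v) ⊎ (∀ v → C v ≡ C₂ v)) where

    private
      closed₁ : Closed G U C₁
      closed₁ = component-closed G comp₁
      closed₂ : Closed G U C₂
      closed₂ = component-closed G comp₂

    chain-in-components : ∀ {M} → Chain E M → All InU M → (∀ w → InU w → (C₁ ∪ C₂) w ≡ false → w ∈ M) →
                          ∀ {v} → v ∈ M → C₁ v ≡ true ⊎ C₂ v ≡ true
    chain-in-components c UM leftover⊆M {v} v∈M with (C₁ ∪ C₂) v in K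
    ... | true  = ∪⁻ {K₁ = C₁} {K₂ = C₂} K
    -- otherwise the vertices of U outside C₁ ∪ C₂ would form a third component
    ... | false = third-component (only (U ∖ (C₁ ∪ C₂))
                                     (leftover-component G (∪-closed G closed₁ closed₂) c UM v∈M K leftover⊆M))
      where
      Dv : (U ∖ (C₁ ∪ C₂)) v ≡ true
      Dv = ∖⁺ {K₁ = U} {K₂ = C₁ ∪ C₂} (All.lookup UM v∈M) K
      third-component : (∀ w → (U ∖ (C₁ ∪ C₂)) w ≡ C₁ w) ⊎ (∀ w → (U ∖ (C₁ ∪ C₂)) w ≡ C₂ w) →
                        C₁ v ≡ true ⊎ C₂ v ≡ true
      third-component (inj₁ D≡C₁) = ⊥-elim (Bool.not-¬ (trans (sym (D≡C₁ v)) Dv) (Bool.∨-conicalˡ (C₁ v) (C₂ v) K))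
      third-component (inj₂ D≡C₂) = ⊥-elim (Bool.not-¬ (trans (sym (D≡C₂ v)) Dv) (Bool.∨-conicalʳ (C₁ v) (C₂ v) K))

    cover-twice : ∀ A s M t B {a₁ a₂} → Chain E (A ++ s ∷ M ++ t ∷ B) → (∀ v → v ∈ A ++ s ∷ M ++ t ∷ B) →
                  head (A ++ s ∷ M ++ t ∷ B) ≡ just a₁ → last (A ++ s ∷ M ++ t ∷ B) ≡ just a₂ →
                  C₁ a₁ ≡ true → C₂ a₂ ≡ true → Sep s → Sep t → All InU A → All InU M → All InU B →
                  ∀ v → InU v → C₁ v ≡ true ⊎ C₂ v ≡ true
    cover-twice A s M t B {a₂ = a₂} c all∈ h l Ca₁ Ca₂ sep sep′ UA UM UB v Uv = finish (side Uv)
      where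
      side : ∀ {w} → InU w → C₁ w ≡ true ⊎ C₂ w ≡ true ⊎ w ∈ M
      side {w} Uw with twice-∈-U A s M t B (all∈ w) Uw sep sep′
      ... | inj₁ w∈A        = inj₁ (trans (segment-before closed₁ A c UA h w∈A) Ca₁)
      ... | inj₂ (inj₁ w∈M) = inj₂ (inj₂ w∈M)
      ... | inj₂ (inj₂ w∈B) = inj₂ (inj₁ (trans (segment-after closed₂ (A ++ s ∷ M)
                                (subst (Chain E) (reassoc A s M t B) c) UB
                                (subst (λ q → last q ≡ just a₂) (reassoc A s M t B) l) w∈B) Ca₂))

      leftover⊆M : ∀ w → InU w → (C₁ ∪ C₂) w ≡ false → w ∈ M
      leftover⊆M w Uw K with side Uw
      ... | inj₁ C₁w        = ⊥-elim (Bool.not-¬ C₁w (Bool.∨-conicalˡ (C₁ w) (C₂ w) K))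
      ... | inj₂ (inj₁ C₂w) = ⊥-elim (Bool.not-¬ C₂w (Bool.∨-conicalʳ (C₁ w) (C₂ w) K))
      ... | inj₂ (inj₂ w∈M) = w∈M

      finish : C₁ v ≡ true ⊎ C₂ v ≡ true ⊎ v ∈ M → C₁ v ≡ true ⊎ C₂ v ≡ true
      finish (inj₁ C₁v)        = inj₁ C₁v
      finish (inj₂ (inj₁ C₂v)) = inj₂ C₂v
      finish (inj₂ (inj₂ v∈M)) = chain-in-components (chain-++⁻ˡ M (chain-tail (chain-++⁻ʳ A c))) UM leftover⊆M v∈M

    components-cover : ∀ {a₁ a₂} → HamPath G full a₁ a₂ → C₁ a₁ ≡ true → C₂ a₂ ≡ true →
                      ∀ v → InU v → C₁ v ≡ true ⊎ C₂ v ≡ true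
    components-cover (p , c , (u , sp) , h , l) Ca₁ Ca₂ with crossing u
    ... | avoids Up = ⊥-elim (Sep⇒∉U (inj₁ refl) (All.lookup Up (Equivalence.from (sp x) refl)))
    ... | once A s B refl sep UA UB =
      ⊥-elim (x≢y (trans (once-∈-Sep A s B (Equivalence.from (sp x) refl) (inj₁ refl) UA UB)
                         (sym (once-∈-Sep A s B (Equivalence.from (sp y) refl) (inj₂ refl) UA UB))))
    ... | twice A s M t B refl sep sep′ _ UA UM UB =
      cover-twice A s M t B c (λ v → Equivalence.from (sp v) refl) h l Ca₁ Ca₂ sep sep′ UA UM UB

  module _ {C C′ : VSet n} (comp : IsComponent G U C) (comp′ : IsComponent G U C′)
           (C∩C′ : ∀ v → C v ≡ true → C′ v ≡ true → ⊥) (C∪C′ : ∀ v → InU v → C v ≡ true ⊎ C′ v ≡ true)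
           (¬ham-G : ¬ Hamiltonian G full) (¬ham : ∀ z → ¬ Hamiltonian G (full ─ z)) where

    private
      F F′ : VSet n
      F  = fragment G C x y
      F′ = fragment G C′ x y
      c′ : Fin n
      c′ = proj₁ (proj₁ comp′)
      C′c′ : C′ c′ ≡ true
      C′c′ = proj₂ (proj₁ comp′)
      c′≢x : c′ ≢ x
      c′≢x = proj₁ (U⁻ {c′} (proj₁ (proj₂ comp′) c′ C′c′))
      c′≢y : c′ ≢ y
      c′≢y = proj₂ (U⁻ {c′} (proj₁ (proj₂ comp′) c′ C′c′))
      F′c′ : F′ c′ ≡ true
      F′c′ = fragment⁺ G {C′} {x} {y} {c′} (inj₁ C′c′)

    F∩F′ : ∀ v → F v ≡ true → F′ v ≡ true → Sep v
    F∩F′ v Fv F′v with fragment⁻ G {C} {x} {y} {v} Fv | fragment⁻ G {C′} {x} {y} {v} F′v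
    ... | inj₂ sep | _        = sep
    ... | inj₁ _   | inj₂ sep = sep
    ... | inj₁ Cv  | inj₁ C′v = ⊥-elim (C∩C′ v Cv C′v)

    F∪F′ : ∀ v → F v ≡ true ⊎ F′ v ≡ true
    F∪F′ v with U-or-Sep v
    ... | inj₂ sep = inj₁ (fragment⁺ G {C} {x} {y} {v} (inj₂ sep))
    ... | inj₁ Uv  = Sum.map (λ Cv → fragment⁺ G {C} {x} {y} {v} (inj₁ Cv))
                             (λ C′v → fragment⁺ G {C′} {x} {y} {v} (inj₁ C′v)) (C∪C′ v Uv)

    fragment-strong : ∀ {a} → WeakFragment G F a x y → HamPath G F′ x y → StrongFragment G F a x y
    fragment-strong {a} weak P′ = (weak , Q₁-F) , Q₂-F
      where
      Q₁-F : Q₁ G F x y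
      Q₁-F P = ¬ham-G (hamPaths-glue G x≢y P P′ F′c′ c′≢x c′≢y (λ v → mk⇔ (λ _ → F∪F′ v) (λ _ → refl)) F∩F′)

      Q₂-F : Q₂ G F a x y
      Q₂-F v Fv _ P with fragment⁻ G {C} {x} {y} {v} Fv
      ... | inj₂ (inj₁ refl) = proj₂ (─⁻ {U = F} (hamPath-head G P)) refl
      ... | inj₂ (inj₂ refl) = proj₂ (─⁻ {U = F} (hamPath-last G P)) refl
      ... | inj₁ Cv = ¬ham v (hamPaths-glue G x≢y P P′ F′c′ c′≢x c′≢y F∪F′-v (λ w h → F∩F′ w (proj₁ (─⁻ {U = F} h))))
        where
        F′-avoids : ∀ {w} → F′ w ≡ true → w ≢ v
        F′-avoids {w} F′w refl with fragment⁻ G {C′} {x} {y} {w} F′w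
        ... | inj₁ C′v = C∩C′ v Cv C′v
        ... | inj₂ sep = Sep⇒∉U sep (proj₁ (proj₂ comp) v Cv)
        F∪F′-v : ∀ w → ((full ─ v) w ≡ true) ⇔ ((F ─ v) w ≡ true ⊎ F′ w ≡ true)
        F∪F′-v w = mk⇔
          (λ h → Sum.map₁ (λ Fw → ─⁺ {U = F} Fw (proj₂ (─⁻ {U = full} {v} {w} h))) (F∪F′ w))
          Sum.[ (λ h → ─⁺ {U = full} refl (proj₂ (─⁻ {U = F} {v} {w} h)))
              , (λ F′w → ─⁺ {U = full} refl (F′-avoids F′w)) ]

  module _ {C₁ C₂ : VSet n} (comp₁ : IsComponent G U C₁) (comp₂ : IsComponent G U C₂)
           (C₁∩C₂ : ∀ v → C₁ v ≡ true → C₂ v ≡ true → ⊥) (C₁∪C₂ : ∀ v → InU v → C₁ v ≡ true ⊎ C₂ v ≡ true)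
           (¬ham-G : ¬ Hamiltonian G full) (¬ham : ∀ z → ¬ Hamiltonian G (full ─ z)) {a₁ a₂ : Fin n} where

    private
      F₁ F₂ : VSet n
      F₁ = fragment G C₁ x y
      F₂ = fragment G C₂ x y

    weak⇒medium-or-strong : WeakFragment G F₁ a₁ x y → WeakFragment G F₂ a₂ x y →
                            (MediumFragment G F₁ a₁ x y × MediumFragment G F₂ a₂ x y)
                            ⊎ StrongFragment G F₁ a₁ x y ⊎ StrongFragment G F₂ a₂ x y
    weak⇒medium-or-strong weak₁ weak₂ with hamPath? G F₂ x y | hamPath? G F₁ x y
    ... | yes P₂ | _      = inj₂ (inj₁ (fragment-strong comp₁ comp₂ C₁∩C₂ C₁∪C₂ ¬ham-G ¬ham weak₁ P₂))
    ... | no _   | yes P₁ = inj₂ (inj₂ (fragment-strong comp₂ comp₁ (λ v C₂v C₁v → C₁∩C₂ v C₁v C₂v)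
                                          (λ v Uv → Sum.swap (C₁∪C₂ v Uv)) ¬ham-G ¬ham weak₂ P₁))
    ... | no ¬P₂ | no ¬P₁ = inj₁ ((weak₁ , ¬P₁) , (weak₂ , ¬P₂))

theorem10 : ∀ {n} (G : Graph n) →
    TwoConnected G → TwoLeafStable G → FaultCost G 1 →
    (a₁ a₂ : Fin n) →
    HamPath G full a₁ a₂ →
    (∀ z → z ≢ a₁ → z ≢ a₂ → HamPath G (full ─ z) a₁ a₂) →
    (x y : Fin n) → adj G x y ≡ true → TwoSeparator G x y →
    (C₁ C₂ : VSet n) →
    IsComponent G ((full ─ x) ─ y) C₁ →
    IsComponent G ((full ─ x) ─ y) C₂ →
    ¬ (∀ v → C₁ v ≡ C₂ v) →
    (∀ C → IsComponent G ((full ─ x) ─ y) C → (∀ v → C v ≡ C₁ v) ⊎ (∀ v → C v ≡ C₂ v)) →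
    fragment G C₁ x y a₁ ≡ true →
    fragment G C₂ x y a₂ ≡ true →
    WeakFragment G (fragment G C₁ x y) a₁ x y
    × WeakFragment G (fragment G C₂ x y) a₂ x y
    × ((MediumFragment G (fragment G C₁ x y) a₁ x y × MediumFragment G (fragment G C₂ x y) a₂ x y)
       ⊎ StrongFragment G (fragment G C₁ x y) a₁ x y
       ⊎ StrongFragment G (fragment G C₂ x y) a₂ x y)
theorem10 G _ (ml , ml-z) _ a₁ a₂ hp hz x y xy (x≢y , _) C₁ C₂ comp₁ comp₂ C₁≢C₂ only Fa₁ Fa₂ =
  weak₁ , weak₂ , weak⇒medium-or-strong comp₁ comp₂ C₁∩C₂ C₁∪C₂ ¬ham-G ¬ham weak₁ weak₂
  where
  open Separator G x≢y xy

  ¬ham-G : ¬ Hamiltonian G full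
  ¬ham-G = ML-2⇒¬Hamiltonian G ml

  ¬ham : ∀ z → ¬ Hamiltonian G (full ─ z)
  ¬ham z = ML-2⇒¬Hamiltonian G (ml-z z)

  C₁∩C₂ : ∀ v → C₁ v ≡ true → C₂ v ≡ true → ⊥
  C₁∩C₂ = components-disjoint G comp₁ comp₂ C₁≢C₂

  hp′ : HamPath G full a₂ a₁
  hp′ = hamPath-reverse G hp

  hz′ : ∀ z → z ≢ a₂ → z ≢ a₁ → HamPath G (full ─ z) a₂ a₁
  hz′ z z≢a₂ z≢a₁ = hamPath-reverse G (hz z z≢a₁ z≢a₂)

  C₁a₁ : C₁ a₁ ≡ true
  C₁a₁ = endpoint-in-component comp₁ comp₂ C₁∩C₂ ¬ham hp hz Fa₁ Fa₂

  C₂a₂ : C₂ a₂ ≡ true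
  C₂a₂ = endpoint-in-component comp₂ comp₁ (λ v C₂v C₁v → C₁∩C₂ v C₁v C₂v) ¬ham hp′ hz′ Fa₂ Fa₁

  C₁∪C₂ : ∀ v → InU v → C₁ v ≡ true ⊎ C₂ v ≡ true
  C₁∪C₂ = components-cover comp₁ comp₂ only hp C₁a₁ C₂a₂

  weak₁ : WeakFragment G (fragment G C₁ x y) a₁ x y
  weak₁ = fragment-weak comp₁ C₁a₁ (proj₁ (proj₂ comp₂) a₂ C₂a₂) (Bool.¬-not λ C₁a₂ → C₁∩C₂ a₂ C₁a₂ C₂a₂) hp hz

  weak₂ : WeakFragment G (fragment G C₂ x y) a₂ x y
  weak₂ = fragment-weak comp₂ C₂a₂ (proj₁ (proj₂ comp₁) a₁ C₁a₁) (Bool.¬-not λ C₂a₁ → C₁∩C₂ a₁ C₁a₁ C₂a₁) hp′ hz′
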